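{- Let $s\ge1$ and $k\ge0$ be integers and let $\mathbb F_k(x)=\sum_{n\ge0}{n \brack k}_{[s]}x^n$. Then $$\mathbb F_k(x)=\frac{x^{k}q^{\binom{k}{2}}\prod_{j=0}^{k-1}\left(1+q^{j}x+(q^{j}x)^{2}+\cdots+(q^{j}x)^{s-1}\right)}{\prod_{j=0}^{k}(1-q^{j}x)}.$$
   Context: The $q$-quasi-bi$^{s}$nomial coefficients ${n \brack k}_{[s]}$ (for integers $n,k$; polynomials in $q$) are defined by ${0\brack 0}_{[s]}=1$, ${n\brack k}_{[s]}=0$ whenever $k\notin\{0,\ldots,n\}$, and for $n\ge1$, $0\le k\le n$, by the recurrence $${n \brack k}_{[s]}={n-1 \brack k}_{[s]}+\sum_{j=1}^{s}q^{n-j}{n-j \brack k-1}_{[s]}.$$ -}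

module Defs where

open import Level using (Level)
open import Algebra.Bundles using (CommutativeRing)
open import Data.Nat using (ℕ; zero; suc; _∸_; _≤_; _<_; _≤?_; _<?_)
open import Relation.Nullary using (yes; no)

-- All constructions are carried out over an arbitrary commutative ring R,
-- with q an arbitrary element of R (q "generic" = the polynomial ring ℤ[q]).
module QuasiBinomial {c ℓ : Level} (R : CommutativeRing c ℓ) where
  open CommutativeRing R using (Carrier; _+_; _*_; 0#; 1#)

  pow : Carrier → ℕ → Carrier
  pow a zero    = 1#
  pow a (suc n) = a * pow a n

  sum1 : ℕ → (ℕ → Carrier) → Carrier
  sum1 zero    f = 0#
  sum1 (suc m) f = sum1 m f + f (suc m)

  sum0 : ℕ → (ℕ → Carrier) → Carrier
  sum0 zero    f = f zero
  sum0 (suc n) f = sum0 n f + f (suc n)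

  -- value of a row at index m ∸ j, interpreted as 0 when m - j < 0
  -- (then k-1 ∉ {0,…,m-j} since the range is empty)
  shifted : (ℕ → Carrier) → ℕ → ℕ → Carrier
  shifted f m j with j ≤? m
  ... | yes _ = f (m ∸ j)
  ... | no  _ = 0#

  guardLe : ℕ → ℕ → Carrier → Carrier
  guardLe k n v with k ≤? n
  ... | yes _ = v
  ... | no  _ = 0#

  -- row k n = [n brack k]_{[s]} at the element q, defined by the recurrence.
  -- For k = 0 the row "k-1" is identically 0 (k - 1 = -1 ∉ {0..n}).
  row : (s : ℕ) (q : Carrier) → ℕ → ℕ → Carrier
  row s q zero    zero    = 1#
  row s q zero    (suc n) =
    row s q zero n + sum1 s (λ j → pow q (suc n ∸ j) * shifted (λ _ → 0#) (suc n) j)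
  row s q (suc k) zero    = 0#
  row s q (suc k) (suc n) = guardLe (suc k) (suc n) (
    row s q (suc k) n + sum1 s (λ j → pow q (suc n ∸ j) * shifted (row s q k) (suc n) j))

  qbin : (s : ℕ) (q : Carrier) (n k : ℕ) → Carrier
  qbin s q n k = row s q k n

  -- formal power series in x: coefficient sequences
  PS : Set c
  PS = ℕ → Carrier

  _·_ : PS → PS → PS
  (f · g) n = sum0 n (λ i → f i * g (n ∸ i))

  onePS : PS
  onePS zero    = 1#
  onePS (suc _) = 0#

  prodPS : ℕ → (ℕ → PS) → PS
  prodPS zero    F = onePS
  prodPS (suc m) F = prodPS m F · F m

  mono : Carrier → ℕ → PS
  mono a d n with n Data.Nat.≟ d
  ... | yes _ = a
  ... | no  _ = 0#

  truncGeom : ℕ → Carrier → PS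
  truncGeom s a n with n <? s
  ... | yes _ = pow a n
  ... | no  _ = 0#

  -- 1 / (1 - a x) = Σ_{n ≥ 0} a^n x^n
  geom : Carrier → PS
  geom a n = pow a n

  𝔽 : (s : ℕ) (q : Carrier) (k : ℕ) → PS
  𝔽 s q k n = qbin s q n k

  rhs : (s : ℕ) (q : Carrier) (k : ℕ) (choose2 : ℕ) → PS
  rhs s q k choose2 =
    (mono (pow q choose2) k · prodPS k (λ j → truncGeom s (pow q j)))
      · prodPS (suc k) (λ j → geom (pow q j))

-- Let T(x) = 1 + x + … + x^(s-1) and let P_k(x) be the right-hand side. Splitting off the
-- j = 0 factors of both products gives P_(k+1)(x) = x · T(x) · P_k(qx) / (1 - x).
-- Multiplication by x/(1-x) turns a series into its shifted partial sums and multiplication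
-- by T sums s consecutive coefficients, so
--   [x^(n+1)] P_(k+1) = [x^n] P_(k+1) + Σ_(j=1..s) q^(n+1-j) [x^(n+1-j)] P_k,
-- the defining recurrence of the coefficients. With P_0 = 1/(1-x) and [x^0] P_(k+1) = 0,
-- induction on k and n finishes the proof.
module Submission where

open import Defs
open import Level using (Level)
open import Algebra.Bundles using (CommutativeRing; CommutativeMonoid)
import Algebra.Properties.CommutativeSemigroup as CommutativeSemigroupProperties
import Algebra.Properties.CommutativeSemiring.Exp as Exp
import Algebra.Solver.CommutativeMonoid as CommutativeMonoidSolver
open import Data.Nat using (ℕ; _≥_; zero; suc; _∸_; _≤_; _<_; z≤n; s≤s; _≤?_; _<?_; _≟_)
  renaming (_+_ to _+ℕ_)
open import Data.Nat.Properties
  using (≤-refl; ≤-pred; m≤n⇒m≤1+n; ≤∧≢⇒<; <-cmp; <⇒≢; <⇒≱; ≰⇒>; ≤-<-trans; <-trans; n<1+n;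
         m∸n≤m; m∸[m∸n]≡n; m+[n∸m]≡n; m+n∸m≡n; m≤m+n)
open import Data.Nat.Combinatorics using (_C_; nC1≡n; nCk+nC[k+1]≡[n+1]C[k+1])
open import Data.Product using (_,_)
open import Function using (_∘_)
import Relation.Binary.Reasoning.Setoid as SetoidReasoning
open import Relation.Binary.Definitions using (tri<; tri≈; tri>)
open import Relation.Nullary using (yes; no; ¬_; contradiction)
open import Relation.Binary.PropositionalEquality as P using (_≡_; _≢_)

module _ {c ℓ : Level} (R : CommutativeRing c ℓ) where
  open CommutativeRing R hiding (zero)
  open QuasiBinomial R
  open Exp commutativeSemiring using (_^_; ^-homo-*; ^-distrib-*)
  module ≈-Reasoning = SetoidReasoning setoid

  *-interchange : ∀ a b c d → (a * b) * (c * d) ≈ (a * c) * (b * d)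
  *-interchange = CommutativeSemigroupProperties.interchange *-commutativeSemigroup

  +-interchange : ∀ a b c d → (a + b) + (c + d) ≈ (a + c) + (b + d)
  +-interchange = CommutativeSemigroupProperties.interchange +-commutativeSemigroup

  pow≡^ : ∀ a n → pow a n ≡ a ^ n
  pow≡^ a zero    = P.refl
  pow≡^ a (suc n) = P.cong (a *_) (pow≡^ a n)

  pow-+ : ∀ a m n → pow a (m +ℕ n) ≈ pow a m * pow a n
  pow-+ a m n rewrite pow≡^ a (m +ℕ n) | pow≡^ a m | pow≡^ a n = ^-homo-* a m n

  pow-* : ∀ a b n → pow (a * b) n ≈ pow a n * pow b n
  pow-* a b n rewrite pow≡^ (a * b) n | pow≡^ a n | pow≡^ b n = ^-distrib-* a b n

  pow-1# : ∀ n → pow 1# n ≈ 1#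
  pow-1# zero    = refl
  pow-1# (suc n) = trans (*-identityˡ _) (pow-1# n)

  sum0-cong≤ : ∀ n {f g : ℕ → Carrier} → (∀ i → i ≤ n → f i ≈ g i) → sum0 n f ≈ sum0 n g
  sum0-cong≤ zero    f≈g = f≈g 0 z≤n
  sum0-cong≤ (suc n) f≈g =
    +-cong (sum0-cong≤ n (λ i i≤n → f≈g i (m≤n⇒m≤1+n i≤n))) (f≈g (suc n) ≤-refl)

  sum0-cong : ∀ n {f g : ℕ → Carrier} → (∀ i → f i ≈ g i) → sum0 n f ≈ sum0 n g
  sum0-cong n f≈g = sum0-cong≤ n (λ i _ → f≈g i)

  sum0-≈0# : ∀ n {f : ℕ → Carrier} → (∀ i → f i ≈ 0#) → sum0 n f ≈ 0#
  sum0-≈0# zero    f≈0 = f≈0 0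
  sum0-≈0# (suc n) f≈0 = trans (+-cong (sum0-≈0# n f≈0) (f≈0 (suc n))) (+-identityˡ 0#)

  sum0-distrib-+ : ∀ n (f g : ℕ → Carrier) → sum0 n (λ i → f i + g i) ≈ sum0 n f + sum0 n g
  sum0-distrib-+ zero    f g = refl
  sum0-distrib-+ (suc n) f g = trans (+-congʳ (sum0-distrib-+ n f g)) (+-interchange _ _ _ _)

  *-distribˡ-sum0 : ∀ n a (f : ℕ → Carrier) → a * sum0 n f ≈ sum0 n (λ i → a * f i)
  *-distribˡ-sum0 zero    a f = refl
  *-distribˡ-sum0 (suc n) a f = trans (distribˡ _ _ _) (+-congʳ (*-distribˡ-sum0 n a f))

  *-distribʳ-sum0 : ∀ n a (f : ℕ → Carrier) → sum0 n f * a ≈ sum0 n (λ i → f i * a)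
  *-distribʳ-sum0 zero    a f = refl
  *-distribʳ-sum0 (suc n) a f = trans (distribʳ _ _ _) (+-congʳ (*-distribʳ-sum0 n a f))

  sum0-suc-head : ∀ n (f : ℕ → Carrier) → sum0 (suc n) f ≈ f 0 + sum0 n (f ∘ suc)
  sum0-suc-head zero    f = refl
  sum0-suc-head (suc n) f = trans (+-congʳ (sum0-suc-head n f)) (+-assoc _ _ _)

  sum0-reverse : ∀ n (f : ℕ → Carrier) → sum0 n f ≈ sum0 n (λ i → f (n ∸ i))
  sum0-reverse zero    f = refl
  sum0-reverse (suc n) f = begin
    sum0 n f + f (suc n)                  ≈⟨ +-congʳ (sum0-reverse n f) ⟩
    sum0 n (λ i → f (n ∸ i)) + f (suc n)  ≈⟨ +-comm _ _ ⟩
    f (suc n) + sum0 n (λ i → f (n ∸ i))  ≈⟨ sum0-suc-head n (λ i → f (suc n ∸ i)) ⟨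
    sum0 (suc n) (λ i → f (suc n ∸ i))    ∎
    where open ≈-Reasoning

  -- Both sides sum H a b c over all a + b + c = n.
  sum0-triangle : ∀ n (H : ℕ → ℕ → ℕ → Carrier) →
    sum0 n (λ i → sum0 i (λ a → H a (i ∸ a) (n ∸ i))) ≈
    sum0 n (λ a → sum0 (n ∸ a) (λ b → H a b (n ∸ a ∸ b)))
  sum0-triangle zero    H = refl
  sum0-triangle (suc n) H = begin
    sum0 (suc n) (λ i → sum0 i (λ a → H a (i ∸ a) (suc n ∸ i)))
      ≈⟨ sum0-suc-head n _ ⟩
    H 0 0 (suc n) + sum0 n (λ i → sum0 (suc i) (λ a → H a (suc i ∸ a) (n ∸ i)))
      ≈⟨ +-congˡ (sum0-cong n (λ i → sum0-suc-head i _)) ⟩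
    H 0 0 (suc n) + sum0 n (λ i → H 0 (suc i) (n ∸ i) + sum0 i (λ a → H (suc a) (i ∸ a) (n ∸ i)))
      ≈⟨ +-congˡ (sum0-distrib-+ n _ _) ⟩
    H 0 0 (suc n) + (sum0 n (λ i → H 0 (suc i) (n ∸ i))
                       + sum0 n (λ i → sum0 i (λ a → H (suc a) (i ∸ a) (n ∸ i))))
      ≈⟨ +-assoc _ _ _ ⟨
    (H 0 0 (suc n) + sum0 n (λ i → H 0 (suc i) (n ∸ i)))
      + sum0 n (λ i → sum0 i (λ a → H (suc a) (i ∸ a) (n ∸ i)))
      ≈⟨ +-congˡ (sum0-triangle n (H ∘ suc)) ⟩
    (H 0 0 (suc n) + sum0 n (λ i → H 0 (suc i) (n ∸ i)))
      + sum0 n (λ a → sum0 (n ∸ a) (λ b → H (suc a) b (n ∸ a ∸ b)))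
      ≈⟨ +-congʳ (sum0-suc-head n (λ b → H 0 b (suc n ∸ b))) ⟨
    sum0 (suc n) (λ b → H 0 b (suc n ∸ b)) + sum0 n (λ a → sum0 (n ∸ a) (λ b → H (suc a) b (n ∸ a ∸ b)))
      ≈⟨ sum0-suc-head n _ ⟨
    sum0 (suc n) (λ a → sum0 (suc n ∸ a) (λ b → H a b (suc n ∸ a ∸ b))) ∎
    where open ≈-Reasoning

  sum1-cong : ∀ m {f g : ℕ → Carrier} → (∀ j → f (suc j) ≈ g (suc j)) → sum1 m f ≈ sum1 m g
  sum1-cong zero    f≈g = refl
  sum1-cong (suc m) f≈g = +-cong (sum1-cong m f≈g) (f≈g m)

  sum1-≈0# : ∀ m {f : ℕ → Carrier} → (∀ j → f (suc j) ≈ 0#) → sum1 m f ≈ 0#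
  sum1-≈0# zero    f≈0 = refl
  sum1-≈0# (suc m) f≈0 = trans (+-cong (sum1-≈0# m f≈0) (f≈0 m)) (+-identityˡ 0#)

  mono-≡ : ∀ a d → mono a d d ≈ a
  mono-≡ a d with d ≟ d
  ... | yes _   = refl
  ... | no  d≢d = contradiction P.refl d≢d

  mono-≢ : ∀ a {d n} → n ≢ d → mono a d n ≈ 0#
  mono-≢ a {d} {n} n≢d with n ≟ d
  ... | yes n≡d = contradiction n≡d n≢d
  ... | no  _   = refl

  mono-≢-* : ∀ a {d n} x → n ≢ d → mono a d n * x ≈ 0#
  mono-≢-* a x n≢d = trans (*-congʳ (mono-≢ a n≢d)) (zeroˡ x)

  guardLe-≤ : ∀ {k n} v → k ≤ n → guardLe k n v ≈ v
  guardLe-≤ {k} {n} v k≤n with k ≤? n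
  ... | yes _   = refl
  ... | no  k≰n = contradiction k≤n k≰n

  guardLe-≰ : ∀ {k n} v → ¬ k ≤ n → guardLe k n v ≈ 0#
  guardLe-≰ {k} {n} v k≰n with k ≤? n
  ... | yes k≤n = contradiction k≤n k≰n
  ... | no  _   = refl

  truncGeom-< : ∀ {s} a {n} → n < s → truncGeom s a n ≈ pow a n
  truncGeom-< {s} a {n} n<s with n <? s
  ... | yes _   = refl
  ... | no  n≮s = contradiction n<s n≮s

  truncGeom-≮ : ∀ {s} a {n} → ¬ n < s → truncGeom s a n ≈ 0#
  truncGeom-≮ {s} a {n} n≮s with n <? s
  ... | yes n<s = contradiction n<s n≮s
  ... | no  _   = refl

  shifted-≤ : ∀ f {m j} → j ≤ m → shifted f m j ≈ f (m ∸ j)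
  shifted-≤ f {m} {j} j≤m with j ≤? m
  ... | yes _   = refl
  ... | no  j≰m = contradiction j≤m j≰m

  shifted-≰ : ∀ f {m j} → ¬ j ≤ m → shifted f m j ≈ 0#
  shifted-≰ f {m} {j} j≰m with j ≤? m
  ... | yes j≤m = contradiction j≤m j≰m
  ... | no  _   = refl

  shifted-cong : ∀ {f g : ℕ → Carrier} → (∀ t → f t ≈ g t) → ∀ m j → shifted f m j ≈ shifted g m j
  shifted-cong f≈g m j with j ≤? m
  ... | yes _ = f≈g (m ∸ j)
  ... | no  _ = refl

  infix 4 _≈ₚ_
  record _≈ₚ_ (f g : PS) : Set ℓ where
    constructor coeffwise
    field coeff : ∀ n → f n ≈ g n
  open _≈ₚ_

  ·-cong : ∀ {f f′ g g′} → f ≈ₚ f′ → g ≈ₚ g′ → f · g ≈ₚ f′ · g′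
  ·-cong f≈f′ g≈g′ .coeff n = sum0-cong n (λ i → *-cong (f≈f′ .coeff i) (g≈g′ .coeff (n ∸ i)))

  ·-comm : ∀ f g → f · g ≈ₚ g · f
  ·-comm f g .coeff n = begin
    sum0 n (λ i → f i * g (n ∸ i))              ≈⟨ sum0-reverse n _ ⟩
    sum0 n (λ i → f (n ∸ i) * g (n ∸ (n ∸ i)))  ≈⟨ sum0-cong≤ n swap ⟩
    sum0 n (λ i → g i * f (n ∸ i))              ∎
    where
    open ≈-Reasoning
    swap : ∀ i → i ≤ n → f (n ∸ i) * g (n ∸ (n ∸ i)) ≈ g i * f (n ∸ i)
    swap i i≤n = trans (*-comm _ _) (*-congʳ (reflexive (P.cong g (m∸[m∸n]≡n i≤n))))

  ·-assoc : ∀ f g h → (f · g) · h ≈ₚ f · (g · h)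
  ·-assoc f g h .coeff n = begin
    sum0 n (λ i → sum0 i (λ a → f a * g (i ∸ a)) * h (n ∸ i))
      ≈⟨ sum0-cong n (λ i → *-distribʳ-sum0 i (h (n ∸ i)) _) ⟩
    sum0 n (λ i → sum0 i (λ a → (f a * g (i ∸ a)) * h (n ∸ i)))
      ≈⟨ sum0-triangle n (λ a b c → (f a * g b) * h c) ⟩
    sum0 n (λ a → sum0 (n ∸ a) (λ b → (f a * g b) * h (n ∸ a ∸ b)))
      ≈⟨ sum0-cong n (λ a → sum0-cong (n ∸ a) (λ b → *-assoc _ _ _)) ⟩
    sum0 n (λ a → sum0 (n ∸ a) (λ b → f a * (g b * h (n ∸ a ∸ b))))
      ≈⟨ sum0-cong n (λ a → *-distribˡ-sum0 (n ∸ a) (f a) _) ⟨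
    sum0 n (λ a → f a * sum0 (n ∸ a) (λ b → g b * h (n ∸ a ∸ b))) ∎
    where open ≈-Reasoning

  ·-identityˡ : ∀ f → onePS · f ≈ₚ f
  ·-identityˡ f .coeff zero    = *-identityˡ _
  ·-identityˡ f .coeff (suc n) = begin
    sum0 (suc n) (λ i → onePS i * f (suc n ∸ i))   ≈⟨ sum0-suc-head n _ ⟩
    1# * f (suc n) + sum0 n (λ i → 0# * f (n ∸ i)) ≈⟨ +-cong (*-identityˡ _) (sum0-≈0# n (λ i → zeroˡ _)) ⟩
    f (suc n) + 0#                                 ≈⟨ +-identityʳ _ ⟩
    f (suc n)                                      ∎
    where open ≈-Reasoning

  PS-commutativeMonoid : CommutativeMonoid c ℓ
  PS-commutativeMonoid = record
    { Carrier = PS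
    ; _≈_     = _≈ₚ_
    ; _∙_     = _·_
    ; ε       = onePS
    ; isCommutativeMonoid = record
      { isMonoid = record
        { isSemigroup = record
          { isMagma = record
            { isEquivalence = record
              { refl  = coeffwise (λ n → refl)
              ; sym   = λ f≈g → coeffwise (λ n → sym (f≈g .coeff n))
              ; trans = λ f≈g g≈h → coeffwise (λ n → trans (f≈g .coeff n) (g≈h .coeff n))
              }
            ; ∙-cong = ·-cong
            }
          ; assoc = ·-assoc
          }
        ; identity = ·-identityˡ , λ f → coeffwise λ n → trans (·-comm f onePS .coeff n) (·-identityˡ f .coeff n)
        }
      ; comm = ·-comm
      }
    }

  module PS = CommutativeMonoid PS-commutativeMonoid
  module ≈ₚ-Reasoning = SetoidReasoning PS.setoid

  prodPS-cong : ∀ m {F G : ℕ → PS} → (∀ j → F j ≈ₚ G j) → prodPS m F ≈ₚ prodPS m G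
  prodPS-cong zero    F≈G = PS.refl
  prodPS-cong (suc m) F≈G = ·-cong (prodPS-cong m F≈G) (F≈G m)

  prodPS-suc-head : ∀ m F → prodPS (suc m) F ≈ₚ F 0 · prodPS m (F ∘ suc)
  prodPS-suc-head zero    F = ·-comm onePS (F 0)
  prodPS-suc-head (suc m) F =
    PS.trans (·-cong (prodPS-suc-head m F) (PS.refl {F (suc m)})) (·-assoc (F 0) _ (F (suc m)))

  sum0-mono-* : ∀ n a d (X : ℕ → Carrier) → sum0 n (λ i → mono a d i * X i) ≈ guardLe d n (a * X d)
  sum0-mono-* zero    a zero    X = refl
  sum0-mono-* zero    a (suc d) X = zeroˡ (X 0)
  sum0-mono-* (suc n) a d X with d ≤? n
  ... | yes d≤n = begin
    sum0 n (λ i → mono a d i * X i) + mono a d (suc n) * X (suc n)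
      ≈⟨ +-cong (trans (sum0-mono-* n a d X) (guardLe-≤ _ d≤n)) (mono-≢-* a _ (<⇒≢ (s≤s d≤n) ∘ P.sym)) ⟩
    a * X d + 0#                     ≈⟨ +-identityʳ _ ⟩
    a * X d                          ≈⟨ guardLe-≤ _ (m≤n⇒m≤1+n d≤n) ⟨
    guardLe d (suc n) (a * X d)      ∎
    where open ≈-Reasoning
  ... | no d≰n with d ≟ suc n
  ...   | yes P.refl = begin
    sum0 n (λ i → mono a (suc n) i * X i) + mono a (suc n) (suc n) * X (suc n)
      ≈⟨ +-cong (trans (sum0-mono-* n a (suc n) X) (guardLe-≰ _ d≰n)) (*-congʳ (mono-≡ a (suc n))) ⟩
    0# + a * X (suc n)                       ≈⟨ +-identityˡ _ ⟩
    a * X (suc n)                            ≈⟨ guardLe-≤ {suc n} _ ≤-refl ⟨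
    guardLe (suc n) (suc n) (a * X (suc n))  ∎
    where open ≈-Reasoning
  ...   | no d≢1+n = begin
    sum0 n (λ i → mono a d i * X i) + mono a d (suc n) * X (suc n)
      ≈⟨ +-cong (trans (sum0-mono-* n a d X) (guardLe-≰ _ d≰n)) (mono-≢-* a _ (d≢1+n ∘ P.sym)) ⟩
    0# + 0#                       ≈⟨ +-identityˡ 0# ⟩
    0#                            ≈⟨ guardLe-≰ _ d≰1+n ⟨
    guardLe d (suc n) (a * X d)   ∎
    where
    open ≈-Reasoning
    d≰1+n : ¬ d ≤ suc n
    d≰1+n d≤1+n = d≰n (≤-pred (≤∧≢⇒< d≤1+n d≢1+n))

  mono-·-coeff : ∀ a d g n → (mono a d · g) n ≈ guardLe d n (a * g (n ∸ d))
  mono-·-coeff a d g n = sum0-mono-* n a d (λ i → g (n ∸ i))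

  mono-cong : ∀ {a b} d → a ≈ b → mono a d ≈ₚ mono b d
  mono-cong d a≈b .coeff n with n ≟ d
  ... | yes _ = a≈b
  ... | no  _ = refl

  mono-· : ∀ a b d e → mono a d · mono b e ≈ₚ mono (a * b) (d +ℕ e)
  mono-· a b d e .coeff n with d ≤? n
  ... | no d≰n = begin
    (mono a d · mono b e) n  ≈⟨ mono-·-coeff a d (mono b e) n ⟩
    guardLe d n _            ≈⟨ guardLe-≰ _ d≰n ⟩
    0#                       ≈⟨ mono-≢ (a * b) (λ n≡d+e → d≰n (P.subst (d ≤_) (P.sym n≡d+e) (m≤m+n d e))) ⟨
    mono (a * b) (d +ℕ e) n  ∎
    where open ≈-Reasoning
  ... | yes d≤n with n ∸ d ≟ e
  ...   | yes n∸d≡e = begin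
    (mono a d · mono b e) n   ≈⟨ mono-·-coeff a d (mono b e) n ⟩
    guardLe d n _             ≈⟨ guardLe-≤ _ d≤n ⟩
    a * mono b e (n ∸ d)      ≈⟨ *-congˡ (trans (reflexive (P.cong (mono b e) n∸d≡e)) (mono-≡ b e)) ⟩
    a * b                     ≈⟨ trans (reflexive (P.cong (mono (a * b) (d +ℕ e)) n≡d+e)) (mono-≡ (a * b) (d +ℕ e)) ⟨
    mono (a * b) (d +ℕ e) n   ∎
    where
    open ≈-Reasoning
    n≡d+e : n ≡ d +ℕ e
    n≡d+e = P.trans (P.sym (m+[n∸m]≡n d≤n)) (P.cong (d +ℕ_) n∸d≡e)
  ...   | no n∸d≢e = begin
    (mono a d · mono b e) n   ≈⟨ mono-·-coeff a d (mono b e) n ⟩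
    guardLe d n _             ≈⟨ guardLe-≤ _ d≤n ⟩
    a * mono b e (n ∸ d)      ≈⟨ trans (*-congˡ (mono-≢ b n∸d≢e)) (zeroʳ a) ⟩
    0#                        ≈⟨ mono-≢ (a * b) (λ n≡d+e → n∸d≢e (P.trans (P.cong (_∸ d) n≡d+e) (m+n∸m≡n d e))) ⟨
    mono (a * b) (d +ℕ e) n   ∎
    where open ≈-Reasoning

  x·-coeff-zero : ∀ f → (mono 1# 1 · f) 0 ≈ 0#
  x·-coeff-zero f = zeroˡ (f 0)

  x·-coeff-suc : ∀ f n → (mono 1# 1 · f) (suc n) ≈ f n
  x·-coeff-suc f n = trans (mono-·-coeff 1# 1 f (suc n)) (*-identityˡ (f n))

  ·-geom-1#-coeff : ∀ f n → (f · geom 1#) n ≈ sum0 n f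
  ·-geom-1#-coeff f n = sum0-cong n (λ i → trans (*-congˡ (pow-1# (n ∸ i))) (*-identityʳ (f i)))

  x·-[·-geom-1#]-coeff : ∀ f n → (mono 1# 1 · (f · geom 1#)) (suc n) ≈ sum0 n f
  x·-[·-geom-1#]-coeff f n = trans (x·-coeff-suc (f · geom 1#) n) (·-geom-1#-coeff f n)

  x·-[·-geom-1#]-coeff-suc : ∀ f n →
    (mono 1# 1 · (f · geom 1#)) (suc n) ≈ (mono 1# 1 · (f · geom 1#)) n + f n
  x·-[·-geom-1#]-coeff-suc f zero = begin
    (mono 1# 1 · (f · geom 1#)) 1        ≈⟨ x·-[·-geom-1#]-coeff f 0 ⟩
    f 0                                  ≈⟨ +-identityˡ _ ⟨
    0# + f 0                             ≈⟨ +-congʳ (x·-coeff-zero (f · geom 1#)) ⟨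
    (mono 1# 1 · (f · geom 1#)) 0 + f 0  ∎
    where open ≈-Reasoning
  x·-[·-geom-1#]-coeff-suc f (suc n) = begin
    (mono 1# 1 · (f · geom 1#)) (suc (suc n))        ≈⟨ x·-[·-geom-1#]-coeff f (suc n) ⟩
    sum0 n f + f (suc n)                             ≈⟨ +-congʳ (x·-[·-geom-1#]-coeff f n) ⟨
    (mono 1# 1 · (f · geom 1#)) (suc n) + f (suc n)  ∎
    where open ≈-Reasoning

  truncGeom-1#-suc : ∀ s i → truncGeom (suc s) 1# i ≈ truncGeom s 1# i + mono 1# s i
  truncGeom-1#-suc s i with <-cmp i s
  ... | tri< i<s _ _ = begin
    truncGeom (suc s) 1# i          ≈⟨ truncGeom-< 1# (m≤n⇒m≤1+n i<s) ⟩
    pow 1# i                        ≈⟨ +-identityʳ _ ⟨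
    pow 1# i + 0#                   ≈⟨ +-cong (truncGeom-< 1# i<s) (mono-≢ 1# (<⇒≢ i<s)) ⟨
    truncGeom s 1# i + mono 1# s i  ∎
    where open ≈-Reasoning
  ... | tri≈ i≮s P.refl _ = begin
    truncGeom (suc s) 1# s          ≈⟨ trans (truncGeom-< {suc s} 1# ≤-refl) (pow-1# s) ⟩
    1#                              ≈⟨ +-identityˡ _ ⟨
    0# + 1#                         ≈⟨ +-cong (truncGeom-≮ 1# i≮s) (mono-≡ 1# s) ⟨
    truncGeom s 1# s + mono 1# s s  ∎
    where open ≈-Reasoning
  ... | tri> i≮s i≢s s<i = begin
    truncGeom (suc s) 1# i          ≈⟨ truncGeom-≮ 1# (<⇒≱ s<i ∘ ≤-pred) ⟩
    0#                              ≈⟨ +-identityˡ _ ⟨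
    0# + 0#                         ≈⟨ +-cong (truncGeom-≮ 1# i≮s) (mono-≢ 1# i≢s) ⟨
    truncGeom s 1# i + mono 1# s i  ∎
    where open ≈-Reasoning

  truncGeom-1#-·-coeff : ∀ s (W : PS) m → (truncGeom s 1# · W) m ≈ sum1 s (shifted W (suc m))
  truncGeom-1#-·-coeff zero W m = sum0-≈0# m (λ i → zeroˡ (W (m ∸ i)))
  truncGeom-1#-·-coeff (suc s) W m = begin
    sum0 m (λ i → truncGeom (suc s) 1# i * W (m ∸ i))
      ≈⟨ sum0-cong m (λ i → trans (*-congʳ (truncGeom-1#-suc s i)) (distribʳ _ _ _)) ⟩
    sum0 m (λ i → truncGeom s 1# i * W (m ∸ i) + mono 1# s i * W (m ∸ i))
      ≈⟨ sum0-distrib-+ m _ _ ⟩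
    (truncGeom s 1# · W) m + (mono 1# s · W) m
      ≈⟨ +-cong (truncGeom-1#-·-coeff s W m) (mono-·-coeff 1# s W m) ⟩
    sum1 s (shifted W (suc m)) + guardLe s m (1# * W (m ∸ s))
      ≈⟨ +-congˡ newest ⟩
    sum1 s (shifted W (suc m)) + shifted W (suc m) (suc s) ∎
    where
    open ≈-Reasoning
    newest : guardLe s m (1# * W (m ∸ s)) ≈ shifted W (suc m) (suc s)
    newest with s ≤? m
    ... | yes s≤m = trans (*-identityˡ _) (sym (shifted-≤ W (s≤s s≤m)))
    ... | no  s≰m = sym (shifted-≰ W (s≰m ∘ ≤-pred))

  -- f(x) ↦ f(ax)
  dilate : Carrier → PS → PS
  dilate a f n = pow a n * f n

  dilate-· : ∀ a f g → dilate a (f · g) ≈ₚ dilate a f · dilate a g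
  dilate-· a f g .coeff n = begin
    pow a n * sum0 n (λ i → f i * g (n ∸ i))
      ≈⟨ *-distribˡ-sum0 n _ _ ⟩
    sum0 n (λ i → pow a n * (f i * g (n ∸ i)))
      ≈⟨ sum0-cong≤ n (λ i i≤n → trans (*-congʳ (split i≤n)) (*-interchange _ _ _ _)) ⟩
    sum0 n (λ i → (pow a i * f i) * (pow a (n ∸ i) * g (n ∸ i))) ∎
    where
    open ≈-Reasoning
    split : ∀ {i} → i ≤ n → pow a n ≈ pow a i * pow a (n ∸ i)
    split {i} i≤n = trans (reflexive (P.cong (pow a) (P.sym (m+[n∸m]≡n i≤n)))) (pow-+ a i (n ∸ i))

  dilate-onePS : ∀ a → dilate a onePS ≈ₚ onePS
  dilate-onePS a .coeff zero    = *-identityˡ 1#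
  dilate-onePS a .coeff (suc n) = zeroʳ _

  dilate-prodPS : ∀ a m F → dilate a (prodPS m F) ≈ₚ prodPS m (dilate a ∘ F)
  dilate-prodPS a zero    F = dilate-onePS a
  dilate-prodPS a (suc m) F =
    PS.trans (dilate-· a (prodPS m F) (F m)) (·-cong (dilate-prodPS a m F) (PS.refl {dilate a (F m)}))

  prodPS-suc-dilate : ∀ a m F → (∀ j → F (suc j) ≈ₚ dilate a (F j)) →
    prodPS (suc m) F ≈ₚ F 0 · dilate a (prodPS m F)
  prodPS-suc-dilate a m F F-step = PS.trans (prodPS-suc-head m F)
    (·-cong PS.refl (PS.trans (prodPS-cong m F-step) (PS.sym (dilate-prodPS a m F))))

  dilate-geom : ∀ a b → dilate a (geom b) ≈ₚ geom (a * b)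
  dilate-geom a b .coeff n = sym (pow-* a b n)

  dilate-truncGeom : ∀ s a b → dilate a (truncGeom s b) ≈ₚ truncGeom s (a * b)
  dilate-truncGeom s a b .coeff n with n <? s
  ... | yes _ = sym (pow-* a b n)
  ... | no  _ = zeroʳ _

  dilate-mono : ∀ a b d → dilate a (mono b d) ≈ₚ mono (b * pow a d) d
  dilate-mono a b d .coeff n with n ≟ d
  ... | yes P.refl = *-comm _ _
  ... | no  _      = zeroʳ _

  shifted-dilate : ∀ a f m j → shifted (dilate a f) m j ≈ pow a (m ∸ j) * shifted f m j
  shifted-dilate a f m j with j ≤? m
  ... | yes _ = refl
  ... | no  _ = sym (zeroʳ _)

  module _ (s : ℕ) (q : Carrier) where

    windowSum : (ℕ → Carrier) → ℕ → Carrier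
    windowSum f n = sum1 s (λ j → pow q (suc n ∸ j) * shifted f (suc n) j)

    windowSum-cong : ∀ {f g} → (∀ t → f t ≈ g t) → ∀ n → windowSum f n ≈ windowSum g n
    windowSum-cong f≈g n = sum1-cong s (λ j → *-congˡ (shifted-cong f≈g (suc n) (suc j)))

    row-zero : ∀ n → row s q 0 n ≈ 1#
    row-zero zero    = refl
    row-zero (suc n) = trans (+-cong (row-zero n) (sum1-≈0# s vanish)) (+-identityʳ 1#)
      where
      vanish : ∀ j → pow q (suc n ∸ suc j) * shifted (λ _ → 0#) (suc n) (suc j) ≈ 0#
      vanish j with suc j ≤? suc n
      ... | yes _ = zeroʳ _
      ... | no  _ = zeroʳ _

    row-below : ∀ k m → m < k → row s q k m ≈ 0#
    row-below (suc k) zero    _         = refl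
    row-below (suc k) (suc m) (s≤s m<k) = guardLe-≰ _ (<⇒≱ (s≤s m<k))

    row-suc-suc : ∀ k n → row s q (suc k) (suc n) ≈ row s q (suc k) n + windowSum (row s q k) n
    row-suc-suc k n with suc k ≤? suc n
    ... | yes _   = refl
    ... | no  k≰n = sym (trans (+-cong below (sum1-≈0# s vanish)) (+-identityˡ 0#))
      where
      n<k : n < k
      n<k = ≤-pred (≰⇒> k≰n)
      below : row s q (suc k) n ≈ 0#
      below = row-below (suc k) n (<-trans n<k (n<1+n k))
      vanish : ∀ j → pow q (suc n ∸ suc j) * shifted (row s q k) (suc n) (suc j) ≈ 0#
      vanish j with suc j ≤? suc n
      ... | yes _ = trans (*-congˡ (row-below k (n ∸ j) (≤-<-trans (m∸n≤m n j) n<k))) (zeroʳ _)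
      ... | no  _ = zeroʳ _

    closedForm : ℕ → PS
    closedForm k = rhs s q k (k C 2)

    closedForm-zero : ∀ n → closedForm 0 n ≈ 1#
    closedForm-zero n = begin
      closedForm 0 n                         ≈⟨ ·-cong (·-comm (mono 1# 0) onePS) (·-identityˡ (geom 1#)) .coeff n ⟩
      ((onePS · mono 1# 0) · geom 1#) n      ≈⟨ ·-cong (·-identityˡ (mono 1# 0)) (PS.refl {geom 1#}) .coeff n ⟩
      (mono 1# 0 · geom 1#) n                ≈⟨ mono-·-coeff 1# 0 (geom 1#) n ⟩
      1# * pow 1# n                          ≈⟨ trans (*-identityˡ _) (pow-1# n) ⟩
      1#                                     ∎
      where open ≈-Reasoning

    C2-suc : ∀ k → suc k C 2 ≡ k +ℕ k C 2
    C2-suc k = P.trans (P.sym (nCk+nC[k+1]≡[n+1]C[k+1] k 1)) (P.cong (_+ℕ k C 2) (nC1≡n k))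

    leading-suc : ∀ k → mono (pow q (suc k C 2)) (suc k) ≈ₚ mono 1# 1 · dilate q (mono (pow q (k C 2)) k)
    leading-suc k = begin
      mono (pow q (suc k C 2)) (suc k)               ≈⟨ mono-cong (suc k) coefficient ⟩
      mono (1# * (pow q (k C 2) * pow q k)) (suc k)  ≈⟨ mono-· 1# _ 1 k ⟨
      mono 1# 1 · mono (pow q (k C 2) * pow q k) k    ≈⟨ ·-cong PS.refl (dilate-mono q _ k) ⟨
      mono 1# 1 · dilate q (mono (pow q (k C 2)) k)   ∎
      where
      open ≈ₚ-Reasoning
      coefficient : pow q (suc k C 2) ≈ 1# * (pow q (k C 2) * pow q k)
      coefficient = trans (reflexive (P.cong (pow q) (C2-suc k)))
        (trans (pow-+ q k (k C 2)) (trans (*-comm _ _) (sym (*-identityˡ _))))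

    closedForm-suc : ∀ k →
      closedForm (suc k) ≈ₚ mono 1# 1 · ((truncGeom s 1# · dilate q (closedForm k)) · geom 1#)
    closedForm-suc k = begin
      (M′ · prodPS (suc k) T) · prodPS (suc (suc k)) G
        ≈⟨ ·-cong (·-cong (leading-suc k) (prodPS-suc-dilate q k T T-suc)) (prodPS-suc-dilate q (suc k) G G-suc) ⟩
      ((mono 1# 1 · dilate q M) · (T 0 · dilate q P)) · (G 0 · dilate q Q)
        ≈⟨ solve 6 (λ x m t p g r → ((x ⊕ m) ⊕ (t ⊕ p)) ⊕ (g ⊕ r) ⊜ x ⊕ ((t ⊕ ((m ⊕ p) ⊕ r)) ⊕ g))
                 PS.refl (mono 1# 1) (dilate q M) (T 0) (dilate q P) (G 0) (dilate q Q) ⟩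
      mono 1# 1 · ((T 0 · ((dilate q M · dilate q P) · dilate q Q)) · G 0)
        ≈⟨ ·-cong (PS.refl {mono 1# 1}) (·-cong (·-cong (PS.refl {T 0}) dilate-MPQ) (PS.refl {G 0})) ⟨
      mono 1# 1 · ((T 0 · dilate q ((M · P) · Q)) · G 0) ∎
      where
      open ≈ₚ-Reasoning
      open CommutativeMonoidSolver PS-commutativeMonoid using (solve; _⊜_; _⊕_)
      T G : ℕ → PS
      T j = truncGeom s (pow q j)
      G j = geom (pow q j)
      M M′ P Q : PS
      M  = mono (pow q (k C 2)) k
      M′ = mono (pow q (suc k C 2)) (suc k)
      P  = prodPS k T
      Q  = prodPS (suc k) G
      T-suc : ∀ j → T (suc j) ≈ₚ dilate q (T j)
      T-suc j = PS.sym (dilate-truncGeom s q (pow q j))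
      G-suc : ∀ j → G (suc j) ≈ₚ dilate q (G j)
      G-suc j = PS.sym (dilate-geom q (pow q j))
      dilate-MPQ : dilate q ((M · P) · Q) ≈ₚ (dilate q M · dilate q P) · dilate q Q
      dilate-MPQ = PS.trans (dilate-· q (M · P) Q) (·-cong (dilate-· q M P) (PS.refl {dilate q Q}))

    closedForm-suc-zero : ∀ k → closedForm (suc k) 0 ≈ 0#
    closedForm-suc-zero k =
      trans (closedForm-suc k .coeff 0) (x·-coeff-zero ((truncGeom s 1# · dilate q (closedForm k)) · geom 1#))

    closedForm-suc-suc : ∀ k n →
      closedForm (suc k) (suc n) ≈ closedForm (suc k) n + windowSum (closedForm k) n
    closedForm-suc-suc k n = begin
      closedForm (suc k) (suc n)                ≈⟨ closedForm-suc k .coeff (suc n) ⟩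
      (mono 1# 1 · (V · geom 1#)) (suc n)       ≈⟨ x·-[·-geom-1#]-coeff-suc V n ⟩
      (mono 1# 1 · (V · geom 1#)) n + V n       ≈⟨ +-cong (sym (closedForm-suc k .coeff n)) windowed ⟩
      closedForm (suc k) n + windowSum (closedForm k) n ∎
      where
      open ≈-Reasoning
      V : PS
      V = truncGeom s 1# · dilate q (closedForm k)
      windowed : V n ≈ windowSum (closedForm k) n
      windowed = trans (truncGeom-1#-·-coeff s _ n)
                       (sum1-cong s (λ j → shifted-dilate q (closedForm k) (suc n) (suc j)))

    row≈closedForm : ∀ k n → row s q k n ≈ closedForm k n
    row≈closedForm zero    n       = trans (row-zero n) (sym (closedForm-zero n))
    row≈closedForm (suc k) zero    = sym (closedForm-suc-zero k)
    row≈closedForm (suc k) (suc n) = begin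
      row s q (suc k) (suc n)
        ≈⟨ row-suc-suc k n ⟩
      row s q (suc k) n + windowSum (row s q k) n
        ≈⟨ +-cong (row≈closedForm (suc k) n) (windowSum-cong (row≈closedForm k) n) ⟩
      closedForm (suc k) n + windowSum (closedForm k) n
        ≈⟨ closedForm-suc-suc k n ⟨
      closedForm (suc k) (suc n) ∎
      where open ≈-Reasoning

mainTheorem12 : ∀ {c ℓ : Level} (R : CommutativeRing c ℓ) (s : ℕ) → s ≥ 1 →
    (k : ℕ) (q : CommutativeRing.Carrier R) (n : ℕ) →
    CommutativeRing._≈_ R (QuasiBinomial.𝔽 R s q k n) (QuasiBinomial.rhs R s q k (k C 2) n)
mainTheorem12 R s _ k q n = row≈closedForm R s q k n
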